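{- Let $p$ be a prime and $k$ an integer with $1 \le k \le p-1$. For $\alpha \in F_p$, let $N_k^*(\alpha)$ denote the number of $k$-subsets of $F_p^* = F_p \setminus \{0\}$ whose elements sum to $\alpha$. Then for every $\alpha \in F_p^*$, $N_k^*(0) = N_k^*(\alpha) + 1$ if $k$ is even, and $N_k^*(0) = N_k^*(\alpha) - 1$ if $k$ is odd.
   Context: $F_p$ denotes the finite field with $p$ elements and $F_p^*$ its nonzero elements. -}

module Defs where

open import Data.Nat using (ℕ; zero; suc; _+_; _%_; NonZero)
open import Data.Bool using (Bool; true; false; if_then_else_)
open import Data.Fin using (Fin; toℕ)
open import Data.Fin.Subset using (Subset; _∈_; ∣_∣)
open import Data.Vec using (Vec; []; _∷_; lookup)
open import Data.List using (List; []; _∷_; _++_; map; length; filter; allFin)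
open import Data.Product using (_×_)
open import Relation.Nullary.Decidable using (¬?; _×-dec_)
open import Relation.Binary.PropositionalEquality using (_≡_)
import Data.Nat as ℕ
import Data.Fin.Subset.Properties as SP
open import Data.Nat.ListAction using (sum)
import Data.Fin as F

zeroF : (p : ℕ) .{{_ : NonZero p}} → Fin p
zeroF (suc n) = F.zero

allSubsets : (n : ℕ) → List (Subset n)
allSubsets zero = [] ∷ []
allSubsets (suc n) = map (true ∷_) (allSubsets n) ++ map (false ∷_) (allSubsets n)

subsetSum : {n : ℕ} → Subset n → ℕ
subsetSum {n} s = sum (map (λ i → if lookup s i then toℕ i else 0) (allFin n))

-- The field F_p is modelled by Fin p, with addition mod p; index 0 is the zero element.
Nstar : (p : ℕ) .{{_ : NonZero p}} → ℕ → Fin p → ℕ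
Nstar p k α = length (filter
  (λ s → ¬? (SP._∈?_ (zeroF p) s) ×-dec
         ((∣ s ∣ ℕ.≟ k) ×-dec (subsetSum s % p ℕ.≟ toℕ α)))
  (allSubsets p))

-- Let N k c count the k-subsets of ℤ/p (0 allowed) with sum c. Translating a subset by 1 adds k to
-- its sum, so N k c = N k (c + k), and as k is invertible mod p, N k is constant. A (j+1)-subset
-- either avoids 0 or is {0} plus a j-subset of F_p^* with the same sum, so
-- N (j+1) c = N* j c + N* (j+1) c, where N* counts subsets of F_p^*. Hence N* j c + N* (j+1) c
-- does not depend on c, and starting from N* 0 0 = 1, N* 0 α = 0 the difference
-- N* j 0 − N* j α alternates between 1 and −1.

module Submission where

open import Defs
open import Data.Nat using (ℕ; zero; suc; _+_; _*_; _∸_; _%_; _≤_; _<_; _≟_; NonZero; s≤s)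
open import Data.Nat.Properties using (+-comm; *-zeroʳ; *-assoc; +-identityʳ; +-cancelʳ-≡; ≤-trans; n≤1+n)
open import Data.Nat.DivMod using (%-distribˡ-+; [m+kn]%n≡m%n; [m+n]%n≡m%n; m<n⇒m%n≡m; m%n<n)
open import Data.Nat.Divisibility using (_∣_; n∣m⇒m%n≡0; m%n≡0⇒n∣m)
open import Data.Nat.Primality using (Prime)
open import Data.Nat.Coprimality as Coprime using (Coprime; coprime-Bézout; prime⇒coprime)
open import Data.Nat.GCD using (module Bézout)
open import Data.Nat.ListAction using (sum)
open import Data.Nat.ListAction.Properties using (sum-++)
open import Data.Nat.Tactic.RingSolver using (solve-∀)
open import Data.Bool using (Bool; true; false; _∧_; if_then_else_)
open import Data.Fin as Fin using (Fin; toℕ)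
open import Data.Fin.Properties using (toℕ<n; toℕ-injective)
open import Data.Fin.Subset using (Subset; _∈_; ∣_∣; ⊥)
open import Data.Fin.Subset.Properties using (_∈?_; ∣⊥∣≡0)
open import Data.Vec using ([]; _∷_; _∷ʳ_; lookup)
open import Data.List using (List; []; _∷_; map; filter; length; tabulate; _++_)
open import Data.List.Properties using (map-++; map-∘; map-tabulate)
open import Data.Product using (_×_; _,_; ∃)
open import Function using (_∘_)
open import Function.Bundles using (mk⇔)
open import Relation.Nullary using (¬_; Dec; does; yes; no; contradiction)
open import Relation.Nullary.Decidable using (¬?; _×-dec_; does-⇔; dec-false)
open import Relation.Unary using (Pred; Decidable)
open import Relation.Binary.PropositionalEquality
open ≡-Reasoning

χ : Bool → ℕ
χ b = if b then 1 else 0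

length-filter≡sum-χ : ∀ {a ℓ} {A : Set a} {P : Pred A ℓ} (P? : Decidable P) (xs : List A) →
                      length (filter P? xs) ≡ sum (map (χ ∘ does ∘ P?) xs)
length-filter≡sum-χ P? [] = refl
length-filter≡sum-χ P? (x ∷ xs) with does (P? x)
... | true  = cong suc (length-filter≡sum-χ P? xs)
... | false = length-filter≡sum-χ P? xs

sumSubsets : (n : ℕ) → (Subset n → ℕ) → ℕ
sumSubsets zero    f = f []
sumSubsets (suc n) f = sumSubsets n (λ t → f (true ∷ t)) + sumSubsets n (λ t → f (false ∷ t))

sumSubsets-cong : ∀ n {f g : Subset n → ℕ} → (∀ s → f s ≡ g s) → sumSubsets n f ≡ sumSubsets n g
sumSubsets-cong zero    f≗g = f≗g []
sumSubsets-cong (suc n) f≗g =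
  cong₂ _+_ (sumSubsets-cong n (λ t → f≗g (true ∷ t))) (sumSubsets-cong n (λ t → f≗g (false ∷ t)))

sumSubsets-0 : ∀ n → sumSubsets n (λ _ → 0) ≡ 0
sumSubsets-0 zero    = refl
sumSubsets-0 (suc n) = cong₂ _+_ (sumSubsets-0 n) (sumSubsets-0 n)

sumSubsets-∣∣≡0 : ∀ n (b : Subset n → Bool) → sumSubsets n (λ t → χ (does (∣ t ∣ ≟ 0) ∧ b t)) ≡ χ (b ⊥)
sumSubsets-∣∣≡0 zero    b = refl
sumSubsets-∣∣≡0 (suc n) b =
  cong₂ _+_ (sumSubsets-0 n) (sumSubsets-∣∣≡0 n (λ t → b (false ∷ t)))

sum-map-allSubsets : ∀ n (f : Subset n → ℕ) → sum (map f (allSubsets n)) ≡ sumSubsets n f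
sum-map-allSubsets zero    f = +-identityʳ (f [])
sum-map-allSubsets (suc n) f = begin
  sum (map f (map (true ∷_) A ++ map (false ∷_) A))
    ≡⟨ cong sum (map-++ f (map (true ∷_) A) (map (false ∷_) A)) ⟩
  sum (map f (map (true ∷_) A) ++ map f (map (false ∷_) A))
    ≡⟨ sum-++ (map f (map (true ∷_) A)) (map f (map (false ∷_) A)) ⟩
  sum (map f (map (true ∷_) A)) + sum (map f (map (false ∷_) A))
    ≡⟨ cong₂ (λ u v → sum u + sum v) (map-∘ A) (map-∘ A) ⟨
  sum (map (f ∘ (true ∷_)) A) + sum (map (f ∘ (false ∷_)) A)
    ≡⟨ cong₂ _+_ (sum-map-allSubsets n _) (sum-map-allSubsets n _) ⟩
  sumSubsets (suc n) f ∎
  where A = allSubsets n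

sumSubsets-∷ʳ : ∀ n (f : Subset (suc n) → ℕ) →
                sumSubsets (suc n) f ≡ sumSubsets n (λ t → f (t ∷ʳ true)) + sumSubsets n (λ t → f (t ∷ʳ false))
sumSubsets-∷ʳ zero    f = refl
sumSubsets-∷ʳ (suc n) f = begin
  sumSubsets (suc n) (λ t → f (true ∷ t)) + sumSubsets (suc n) (λ t → f (false ∷ t))
    ≡⟨ cong₂ _+_ (sumSubsets-∷ʳ n (λ t → f (true ∷ t))) (sumSubsets-∷ʳ n (λ t → f (false ∷ t))) ⟩
  (S (true ∷_) true + S (true ∷_) false) + (S (false ∷_) true + S (false ∷_) false)
    ≡⟨ interchange (S (true ∷_) true) (S (true ∷_) false) (S (false ∷_) true) (S (false ∷_) false) ⟩
  (S (true ∷_) true + S (false ∷_) true) + (S (true ∷_) false + S (false ∷_) false) ∎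
  where
  S : (Subset n → Subset (suc n)) → Bool → ℕ
  S cons x = sumSubsets n (λ t → f (cons t ∷ʳ x))
  interchange : ∀ a b c d → (a + b) + (c + d) ≡ (a + c) + (b + d)
  interchange = solve-∀

-- rotate s is s − 1 in ℤ/(n+1): index i+1 moves to i, and 0 to n.
rotate : ∀ {n} → Subset (suc n) → Subset (suc n)
rotate (x ∷ xs) = xs ∷ʳ x

-- (f ∘ rotate) (b ∷ t) = f (t ∷ʳ b), so this is sumSubsets-∷ʳ read backwards.
sumSubsets-rotate : ∀ n (f : Subset (suc n) → ℕ) → sumSubsets (suc n) (f ∘ rotate) ≡ sumSubsets (suc n) f
sumSubsets-rotate n f = sym (sumSubsets-∷ʳ n f)

∣∷∣ : ∀ {n} x (xs : Subset n) → ∣ x ∷ xs ∣ ≡ χ x + ∣ xs ∣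
∣∷∣ true  xs = refl
∣∷∣ false xs = refl

∣∷ʳ∣ : ∀ {n} (xs : Subset n) x → ∣ xs ∷ʳ x ∣ ≡ ∣ xs ∣ + χ x
∣∷ʳ∣ []          x = trans (∣∷∣ x []) (+-comm (χ x) 0)
∣∷ʳ∣ (true ∷ xs) x = cong suc (∣∷ʳ∣ xs x)
∣∷ʳ∣ (false ∷ xs) x = ∣∷ʳ∣ xs x

∣rotate∣ : ∀ {n} (s : Subset (suc n)) → ∣ rotate s ∣ ≡ ∣ s ∣
∣rotate∣ (x ∷ xs) = trans (∣∷ʳ∣ xs x) (trans (+-comm ∣ xs ∣ (χ x)) (sym (∣∷∣ x xs)))

-- The sum of the elements of s: each element of t is one more than its index in t.
indexSum : ∀ {n} → Subset n → ℕ
indexSum []      = 0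
indexSum (_ ∷ t) = ∣ t ∣ + indexSum t

indexSum-⊥ : ∀ n → indexSum (⊥ {n}) ≡ 0
indexSum-⊥ zero    = refl
indexSum-⊥ (suc n) = cong₂ _+_ (∣⊥∣≡0 n) (indexSum-⊥ n)

indexSum-∷ʳ : ∀ {n} (xs : Subset n) x → indexSum (xs ∷ʳ x) ≡ indexSum xs + χ x * n
indexSum-∷ʳ []       x = sym (*-zeroʳ (χ x))
indexSum-∷ʳ {suc n} (y ∷ ys) x = begin
  ∣ ys ∷ʳ x ∣ + indexSum (ys ∷ʳ x)        ≡⟨ cong₂ _+_ (∣∷ʳ∣ ys x) (indexSum-∷ʳ ys x) ⟩
  ∣ ys ∣ + χ x + (indexSum ys + χ x * n)  ≡⟨ lemma ∣ ys ∣ (indexSum ys) (χ x) n ⟩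
  ∣ ys ∣ + indexSum ys + χ x * suc n      ∎
  where
  lemma : ∀ a b c m → a + c + (b + c * m) ≡ a + b + c * suc m
  lemma = solve-∀

indexSum-rotate : ∀ {n} (s : Subset (suc n)) → indexSum s % suc n ≡ (indexSum (rotate s) + ∣ s ∣) % suc n
indexSum-rotate {n} (x ∷ xs) = begin
  indexSum (x ∷ xs) % suc n                       ≡⟨ [m+kn]%n≡m%n (indexSum (x ∷ xs)) (χ x) (suc n) ⟨
  (∣ xs ∣ + indexSum xs + χ x * suc n) % suc n     ≡⟨ cong (_% suc n) (lemma (indexSum xs) ∣ xs ∣ (χ x) n) ⟨
  (indexSum xs + χ x * n + (χ x + ∣ xs ∣)) % suc n ≡⟨ cong (_% suc n) (cong₂ _+_ (indexSum-∷ʳ xs x) (∣∷∣ x xs)) ⟨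
  (indexSum (xs ∷ʳ x) + ∣ x ∷ xs ∣) % suc n ∎
  where
  lemma : ∀ b a c m → b + c * m + (c + a) ≡ a + b + c * suc m
  lemma = solve-∀

∑∈ : ∀ {n} → Subset n → (Fin n → ℕ) → ℕ
∑∈ s f = sum (tabulate (λ i → if lookup s i then f i else 0))

∑∈-suc : ∀ {n} (s : Subset n) (f : Fin n → ℕ) → ∑∈ s (suc ∘ f) ≡ ∣ s ∣ + ∑∈ s f
∑∈-suc []          f = refl
∑∈-suc (true ∷ s)  f = cong suc (begin
  f Fin.zero + ∑∈ s (suc ∘ f ∘ Fin.suc)      ≡⟨ cong (f Fin.zero +_) (∑∈-suc s (f ∘ Fin.suc)) ⟩
  f Fin.zero + (∣ s ∣ + ∑∈ s (f ∘ Fin.suc))  ≡⟨ +-comm-middle (f Fin.zero) ∣ s ∣ _ ⟩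
  ∣ s ∣ + (f Fin.zero + ∑∈ s (f ∘ Fin.suc))  ∎)
  where
  +-comm-middle : ∀ a b c → a + (b + c) ≡ b + (a + c)
  +-comm-middle = solve-∀
∑∈-suc (false ∷ s) f = ∑∈-suc s (f ∘ Fin.suc)

∑∈-toℕ : ∀ {n} (s : Subset n) → ∑∈ s toℕ ≡ indexSum s
∑∈-toℕ []          = refl
∑∈-toℕ (true ∷ s)  = trans (∑∈-suc s toℕ) (cong (∣ s ∣ +_) (∑∈-toℕ s))
∑∈-toℕ (false ∷ s) = trans (∑∈-suc s toℕ) (cong (∣ s ∣ +_) (∑∈-toℕ s))

subsetSum≡indexSum : ∀ {n} (s : Subset n) → subsetSum s ≡ indexSum s
subsetSum≡indexSum {n} s =
  trans (cong sum (map-tabulate (λ i → i) (λ i → if lookup s i then toℕ i else 0))) (∑∈-toℕ s)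

module _ {n : ℕ} where
  private
    p : ℕ
    p = suc n

  %-+-congʳ : ∀ a b k → a % p ≡ b % p → (a + k) % p ≡ (b + k) % p
  %-+-congʳ a b k a≡b = begin
    (a + k) % p             ≡⟨ %-distribˡ-+ a k p ⟩
    (a % p + k % p) % p     ≡⟨ cong (λ r → (r + k % p) % p) a≡b ⟩
    (b % p + k % p) % p     ≡⟨ %-distribˡ-+ b k p ⟨
    (b + k) % p ∎

  -- k + n * k = k * p, so a further shift by n * k undoes the shift by k.
  %-+-cancelʳ : ∀ a b k → (a + k) % p ≡ (b + k) % p → a % p ≡ b % p
  %-+-cancelʳ a b k a+k≡b+k = begin
    a % p                  ≡⟨ [m+kn]%n≡m%n a k p ⟨
    (a + k * p) % p        ≡⟨ cong (_% p) (lemma a k n) ⟩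
    (a + k + n * k) % p    ≡⟨ %-+-congʳ (a + k) (b + k) (n * k) a+k≡b+k ⟩
    (b + k + n * k) % p    ≡⟨ cong (_% p) (lemma b k n) ⟨
    (b + k * p) % p        ≡⟨ [m+kn]%n≡m%n b k p ⟩
    b % p ∎
    where
    lemma : ∀ c k n → c + k * suc n ≡ c + k + n * k
    lemma = solve-∀

  coprime⇒invertible : ∀ {k} → Coprime k p → ∃ λ m → (m * k) % p ≡ 1 % p
  coprime⇒invertible {k} k⊥p with coprime-Bézout k⊥p
  ... | Bézout.+- x y 1+yp≡xk = x , (begin
    (x * k) % p      ≡⟨ cong (_% p) 1+yp≡xk ⟨
    (1 + y * p) % p  ≡⟨ [m+kn]%n≡m%n 1 y p ⟩
    1 % p ∎)
  -- Here x * k ≡ −1, so x * n * k ≡ −n ≡ 1.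
  ... | Bézout.-+ x y 1+xk≡yp = x * n , (begin
    (x * n * k) % p              ≡⟨ [m+n]%n≡m%n (x * n * k) p ⟨
    (x * n * k + p) % p          ≡⟨ cong (_% p) (lemma x n k) ⟩
    (1 + n * (1 + x * k)) % p    ≡⟨ cong (λ r → (1 + n * r) % p) 1+xk≡yp ⟩
    (1 + n * (y * p)) % p        ≡⟨ cong (λ r → (1 + r) % p) (*-assoc n y p) ⟨
    (1 + n * y * p) % p          ≡⟨ [m+kn]%n≡m%n 1 (n * y) p ⟩
    1 % p ∎)
    where
    lemma : ∀ x n k → x * n * k + suc n ≡ 1 + n * (1 + x * k)
    lemma = solve-∀

%2-suc : ∀ j → suc j % 2 ≡ (1 + j % 2) % 2
%2-suc j = %-distribˡ-+ 1 j 2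

¬2∣⇒%2≡1 : ∀ j → ¬ 2 ∣ j → j % 2 ≡ 1
¬2∣⇒%2≡1 j 2∤j with j % 2 in eq | m%n<n j 2
... | 0           | _               = contradiction (m%n≡0⇒n∣m j 2 eq) 2∤j
... | 1           | _               = refl
... | suc (suc _) | s≤s (s≤s ())

%2-suc-suc : ∀ j → suc (suc j) % 2 ≡ j % 2
%2-suc-suc j = trans (cong (_% 2) (+-comm 2 j)) ([m+n]%n≡m%n j 2)

-- x j − y j = (−1)^j, stated without subtraction.
alternating-% : ∀ (x y : ℕ → ℕ) K → x 0 ≡ y 0 + 1 → (∀ j → j < K → x j + x (suc j) ≡ y j + y (suc j)) →
                ∀ j → j ≤ K → x j + j % 2 ≡ y j + suc j % 2
alternating-% x y K x₀ step zero    _  = trans (+-identityʳ (x 0)) x₀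
alternating-% x y K x₀ step (suc j) j<K = begin
  x (suc j) + suc j % 2  ≡⟨ transfer (x j) (x (suc j)) (y j) (y (suc j)) (j % 2) (suc j % 2)
                               (alternating-% x y K x₀ step j (≤-trans (n≤1+n j) j<K)) (step j j<K) ⟩
  y (suc j) + j % 2      ≡⟨ cong (y (suc j) +_) (%2-suc-suc j) ⟨
  y (suc j) + suc (suc j) % 2 ∎
  where
  transfer : ∀ a b c d e f → a + e ≡ c + f → a + b ≡ c + d → b + f ≡ d + e
  transfer a b c d e f a+e≡c+f a+b≡c+d = +-cancelʳ-≡ (a + e) (b + f) (d + e) (begin
    b + f + (a + e)  ≡⟨ lemma₁ a b e f ⟩
    a + b + (e + f)  ≡⟨ cong (_+ (e + f)) a+b≡c+d ⟩
    c + d + (e + f)  ≡⟨ lemma₂ c d e f ⟩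
    d + e + (c + f)  ≡⟨ cong (d + e +_) a+e≡c+f ⟨
    d + e + (a + e) ∎)
    where
    lemma₁ : ∀ a b e f → b + f + (a + e) ≡ a + b + (e + f)
    lemma₁ = solve-∀
    lemma₂ : ∀ c d e f → c + d + (e + f) ≡ d + e + (c + f)
    lemma₂ = solve-∀

alternating : ∀ (x y : ℕ → ℕ) K → x 0 ≡ y 0 + 1 → (∀ j → j < K → x j + x (suc j) ≡ y j + y (suc j)) →
              ∀ j → j ≤ K → (2 ∣ j → x j ≡ y j + 1) × (¬ 2 ∣ j → x j + 1 ≡ y j)
alternating x y K x₀ step j j≤K = even , odd
  where
  invariant : x j + j % 2 ≡ y j + suc j % 2
  invariant = alternating-% x y K x₀ step j j≤K

  even : 2 ∣ j → x j ≡ y j + 1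
  even 2∣j = begin
    x j              ≡⟨ +-identityʳ (x j) ⟨
    x j + 0          ≡⟨ cong (x j +_) j%2≡0 ⟨
    x j + j % 2      ≡⟨ invariant ⟩
    y j + suc j % 2  ≡⟨ cong (y j +_) (trans (%2-suc j) (cong (λ r → (1 + r) % 2) j%2≡0)) ⟩
    y j + 1          ∎
    where
    j%2≡0 : j % 2 ≡ 0
    j%2≡0 = n∣m⇒m%n≡0 j 2 2∣j

  odd : ¬ 2 ∣ j → x j + 1 ≡ y j
  odd 2∤j = begin
    x j + 1          ≡⟨ cong (x j +_) j%2≡1 ⟨
    x j + j % 2      ≡⟨ invariant ⟩
    y j + suc j % 2  ≡⟨ cong (y j +_) (trans (%2-suc j) (cong (λ r → (1 + r) % 2) j%2≡1)) ⟩
    y j + 0          ≡⟨ +-identityʳ (y j) ⟩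
    y j              ∎
    where
    j%2≡1 : j % 2 ≡ 1
    j%2≡1 = ¬2∣⇒%2≡1 j 2∤j

module _ (n : ℕ) where
  private
    p : ℕ
    p = suc n

  -- N k c counts the k-subsets of ℤ/p with sum ≡ c; N* k c those avoiding 0, i.e. of the form false ∷ t.
  inClass : ℕ → ℕ → Subset p → Bool
  inClass k c s = does (∣ s ∣ ≟ k) ∧ does (indexSum s % p ≟ c % p)

  N : ℕ → ℕ → ℕ
  N k c = sumSubsets p (χ ∘ inClass k c)

  N* : ℕ → ℕ → ℕ
  N* k c = sumSubsets n (χ ∘ inClass k c ∘ (false ∷_))

  N-resp-% : ∀ k c d → c % p ≡ d % p → N k c ≡ N k d
  N-resp-% k c d c≡d = sumSubsets-cong p λ s →
    cong (λ r → χ (does (∣ s ∣ ≟ k) ∧ does (indexSum s % p ≟ r))) c≡d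

  inClass-rotate : ∀ k c s → inClass k c (rotate s) ≡ inClass k (c + k) s
  inClass-rotate k c s = trans sameSize (sumClass-rotate (∣ s ∣ ≟ k))
    where
    sameSize : inClass k c (rotate s) ≡ does (∣ s ∣ ≟ k) ∧ does (indexSum (rotate s) % p ≟ c % p)
    sameSize = cong (λ m → does (m ≟ k) ∧ does (indexSum (rotate s) % p ≟ c % p)) (∣rotate∣ s)

    sumClass-rotate : (d : Dec (∣ s ∣ ≡ k)) →
      does d ∧ does (indexSum (rotate s) % p ≟ c % p) ≡ does d ∧ does (indexSum s % p ≟ (c + k) % p)
    sumClass-rotate (no _)     = refl
    sumClass-rotate (yes refl) =
      does-⇔ (mk⇔ to from) (indexSum (rotate s) % p ≟ c % p) (indexSum s % p ≟ (c + ∣ s ∣) % p)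
      where
      to : indexSum (rotate s) % p ≡ c % p → indexSum s % p ≡ (c + ∣ s ∣) % p
      to h = trans (indexSum-rotate s) (%-+-congʳ (indexSum (rotate s)) c ∣ s ∣ h)
      from : indexSum s % p ≡ (c + ∣ s ∣) % p → indexSum (rotate s) % p ≡ c % p
      from h = %-+-cancelʳ (indexSum (rotate s)) c ∣ s ∣ (trans (sym (indexSum-rotate s)) h)

  N-translate : ∀ k c → N k (c + k) ≡ N k c
  N-translate k c = begin
    N k (c + k)                              ≡⟨ sumSubsets-cong p (cong χ ∘ inClass-rotate k c) ⟨
    sumSubsets p (χ ∘ inClass k c ∘ rotate)  ≡⟨ sumSubsets-rotate n (χ ∘ inClass k c) ⟩
    N k c ∎

  N-translate-* : ∀ k c m → N k (c + m * k) ≡ N k c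
  N-translate-* k c zero    = cong (N k) (+-identityʳ c)
  N-translate-* k c (suc m) = begin
    N k (c + (k + m * k))  ≡⟨ cong (N k) (lemma c k (m * k)) ⟩
    N k (c + m * k + k)    ≡⟨ N-translate k (c + m * k) ⟩
    N k (c + m * k)        ≡⟨ N-translate-* k c m ⟩
    N k c ∎
    where
    lemma : ∀ c k l → c + (k + l) ≡ c + l + k
    lemma = solve-∀

  N-const : ∀ {k} → Coprime k p → ∀ c → N k c ≡ N k 0
  N-const k⊥p zero = refl
  N-const {k} k⊥p (suc c) with coprime⇒invertible k⊥p
  ... | m , mk≡1 = begin
    N k (suc c)      ≡⟨ N-resp-% k (suc c) (c + m * k) c+1≡c+mk ⟩
    N k (c + m * k)  ≡⟨ N-translate-* k c m ⟩
    N k c            ≡⟨ N-const k⊥p c ⟩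
    N k 0 ∎
    where
    c+1≡c+mk : suc c % p ≡ (c + m * k) % p
    c+1≡c+mk = sym (trans (cong (_% p) (+-comm c (m * k))) (%-+-congʳ (m * k) 1 c mk≡1))

  -- ∣ true ∷ t ∣ = suc ∣ t ∣ and indexSum ignores the first bit, so this holds definitionally.
  N-suc : ∀ j c → N (suc j) c ≡ N* j c + N* (suc j) c
  N-suc j c = refl

  N*-adjacent-const : ∀ j → Coprime (suc j) p → ∀ c d → N* j c + N* (suc j) c ≡ N* j d + N* (suc j) d
  N*-adjacent-const j j+1⊥p c d = begin
    N* j c + N* (suc j) c  ≡⟨ N-suc j c ⟨
    N (suc j) c            ≡⟨ N-const j+1⊥p c ⟩
    N (suc j) 0            ≡⟨ N-const j+1⊥p d ⟨
    N (suc j) d            ≡⟨ N-suc j d ⟩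
    N* j d + N* (suc j) d  ∎

  N*-zero : ∀ c → N* 0 c ≡ χ (does (0 ≟ c % p))
  N*-zero c = trans (sumSubsets-∣∣≡0 n (λ t → does (indexSum (false ∷ t) % p ≟ c % p)))
                    (cong (λ r → χ (does (r % p ≟ c % p))) (cong₂ _+_ (∣⊥∣≡0 n) (indexSum-⊥ n)))

  Nstar≡N* : ∀ k α → Nstar p k α ≡ N* k (toℕ α)
  Nstar≡N* k α = begin
    length (filter P? (allSubsets p))                  ≡⟨ length-filter≡sum-χ P? (allSubsets p) ⟩
    sum (map (χ ∘ does ∘ P?) (allSubsets p))           ≡⟨ sum-map-allSubsets p (χ ∘ does ∘ P?) ⟩
    -- P? rejects every true ∷ t by computation.
    sumSubsets n (λ _ → 0) + sumSubsets n (χ ∘ does ∘ P? ∘ (false ∷_))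
      ≡⟨ cong₂ _+_ (sumSubsets-0 n) (sumSubsets-cong n (cong χ ∘ sameClass)) ⟩
    N* k (toℕ α) ∎
    where
    P? : Decidable (λ s → ¬ zeroF p ∈ s × ∣ s ∣ ≡ k × subsetSum s % p ≡ toℕ α)
    P? s = ¬? (zeroF p ∈? s) ×-dec (∣ s ∣ ≟ k) ×-dec (subsetSum s % p ≟ toℕ α)

    sameClass : ∀ t → does (P? (false ∷ t)) ≡ inClass k (toℕ α) (false ∷ t)
    sameClass t = cong₂ (λ a b → does (∣ t ∣ ≟ k) ∧ does (a ≟ b))
                        (cong (_% p) (subsetSum≡indexSum (false ∷ t)))
                        (sym (m<n⇒m%n≡m (toℕ<n α)))

lemma4 : (p : ℕ) .{{_ : NonZero p}} → Prime p → (k : ℕ) → 1 ≤ k → k ≤ p ∸ 1 →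
    (α : Fin p) → α ≢ zeroF p →
    (2 ∣ k → Nstar p k (zeroF p) ≡ Nstar p k α + 1) ×
    (¬ 2 ∣ k → Nstar p k (zeroF p) + 1 ≡ Nstar p k α)
lemma4 (suc n) p-prime k _ k≤n α α≢0
  rewrite Nstar≡N* n k (zeroF (suc n)) | Nstar≡N* n k α =
  alternating (λ j → N* n j 0) (λ j → N* n j (toℕ α)) n N*₀ step k k≤n
  where
  0≢α : 0 ≢ toℕ α % suc n
  0≢α 0≡α = α≢0 (toℕ-injective (trans (sym (m<n⇒m%n≡m (toℕ<n α))) (sym 0≡α)))

  N*₀ : N* n 0 0 ≡ N* n 0 (toℕ α) + 1
  N*₀ = begin
    N* n 0 0                          ≡⟨ N*-zero n 0 ⟩
    0 + 1                             ≡⟨ cong (λ b → χ b + 1) (dec-false (0 ≟ toℕ α % suc n) 0≢α) ⟨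
    χ (does (0 ≟ toℕ α % suc n)) + 1  ≡⟨ cong (_+ 1) (N*-zero n (toℕ α)) ⟨
    N* n 0 (toℕ α) + 1                ∎

  step : ∀ j → j < n → N* n j 0 + N* n (suc j) 0 ≡ N* n j (toℕ α) + N* n (suc j) (toℕ α)
  step j j<n = N*-adjacent-const n j (Coprime.sym (prime⇒coprime p-prime (s≤s j<n))) 0 (toℕ α)
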